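{- Let $m\ge 1$, $0\le i\le m$, let $x = [a_1,a_2,\dots]$ be an irrational number (with $x>1$), and let $y_1,y_2,y_3,\dots$ be any sequence of rational numbers $\geq 1$ converging to $x$. Then the power series expansions of $r^q_{i,m}(y_n)$ stabilize as $n\to\infty$: for every $k \ge 0$ the coefficient of $q^k$ in $r^q_{i,m}(y_n)$ is eventually constant in $n$, and the resulting limit series is $r^q_{i,m}(x)$, i.e. it coincides with the coefficientwise limit of the power series of $r^q_{i,m}(x_n)$ for the convergents $x_n = [a_1,\dots,a_n]$.
   Context: Border strip: for positive integers $a_1,\dots,a_n$, $\mathcal{G}[a_1,\dots,a_n]$ consists of unit boxes $b_1,\dots,b_N$, $N=a_1+\cdots+a_n-1$. If $n=1$ it is a vertical column of $a_1-1$ boxes indexed bottom to top. If $n\ge 2$, each $b_{t+1}$ is directly above or directly right of $b_t$, with step sequence: $a_1-1$ up, $a_2$ right, $a_3$ up, $a_4$ right, ..., alternating, ending with $a_n-1$ steps (right if $n$ even, up if $n$ odd). A $P$-partition with parts at most $m$ is a map $\sigma$ from boxes to $\{0,\dots,m\}$ weakly increasing along rows left to right and along columns top to bottom; its weight is the sum of its values. For $1\le i,j\le m+1$, $\Omega_m^{ij}(\mathcal{G},q) = \sum_\sigma q^{\mathrm{wt}(\sigma)}$ over such $\sigma$ with $\sigma(b_1)\le m+1-i$ and $\sigma(b_N) \le m+1-j$. For a rational $x \geq 1$ with continued fraction $[a_1,\dots,a_n]$ and $\mathcal{G}(x) = \mathcal{G}[a_1,\dots,a_n]$, define $r^q_{i,m}(x)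 := \Omega_m^{m+1-i,1}(\mathcal{G}(x),q)/\Omega_m^{m+1,1}(\mathcal{G}(x),q)$, a rational function whose denominator has constant term $1$, hence a power series in $q$. For irrational $x$, $r^q_{i,m}(x)$ is defined as the coefficientwise limit of the power series $r^q_{i,m}(x_n)$ over the convergents $x_n$ of $x$ (this limit exists). -}

module Defs where

open import Data.Nat as ℕ using (ℕ; zero; suc; _+_; _*_; _∸_; _≤_; _≡ᵇ_; _≤ᵇ_)
open import Data.Nat.DivMod using (_/_; _%_)
open import Data.Bool using (Bool; true; false; _∧_; _∨_; not; if_then_else_)
open import Data.List using (List; []; _∷_; _++_; map; length; filterᵇ; replicate; concatMap; zip; upTo; foldr)
open import Data.Nat.ListAction using (sum)
open import Data.Product using (_×_; _,_; proj₁; proj₂)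
open import Data.Integer as ℤ using (ℤ; +_)
open import Data.Rational as ℚ using (ℚ)
open import Function using (_∘_)

-- Border strips G[a₁,…,aₙ] as the list of box coordinates (x , y)
-- (x = column, growing to the right; y = row, growing upwards),
-- listed in the order b₁ , … , b_N.

data Dir : Set where
  U R : Dir

flip : Dir → Dir
flip U = R
flip R = U

stepsTail : Dir → List ℕ → List Dir
stepsTail d []           = []
stepsTail d (a ∷ [])     = replicate (a ∸ 1) d
stepsTail d (a ∷ b ∷ as) = replicate a d ++ stepsTail (flip d) (b ∷ as)

steps : List ℕ → List Dir
steps []           = []
steps (a ∷ [])     = replicate (a ∸ 2) U      -- column of a₁ - 1 boxes
steps (a ∷ b ∷ as) = replicate (a ∸ 1) U ++ stepsTail R (b ∷ as)

move : Dir → ℕ × ℕ → ℕ × ℕ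
move U (x , y) = (x , suc y)
move R (x , y) = (suc x , y)

walk : ℕ × ℕ → List Dir → List (ℕ × ℕ)
walk p []       = p ∷ []
walk p (d ∷ ds) = p ∷ walk (move d p) ds

numBoxes : List ℕ → ℕ
numBoxes as = sum as ∸ 1

boxes : List ℕ → List (ℕ × ℕ)
boxes as with numBoxes as
... | zero  = []
... | suc _ = walk (0 , 0) (steps as)

assignments : ℕ → ℕ → List (List ℕ)
assignments zero    m = [] ∷ []
assignments (suc N) m = concatMap (λ v → map (v ∷_) (assignments N m)) (upTo (suc m))

allB : {A : Set} → (A → Bool) → List A → Bool
allB p = foldr (λ a r → p a ∧ r) true

pairOK : (ℕ × ℕ) × ℕ → (ℕ × ℕ) × ℕ → Bool
pairOK ((x , y) , v) ((x' , y') , v') =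
  (not ((y ≡ᵇ y') ∧ (x ≤ᵇ x')) ∨ (v ≤ᵇ v'))    -- rows: left to right
  ∧ (not ((x ≡ᵇ x') ∧ (y' ≤ᵇ y)) ∨ (v ≤ᵇ v'))  -- columns: top to bottom

isPPartition : List ((ℕ × ℕ) × ℕ) → Bool
isPPartition bs = allB (λ b → allB (pairOK b) bs) bs

headOK : ℕ → List ℕ → Bool
headOK c []      = true
headOK c (v ∷ _) = v ≤ᵇ c

lastOK : ℕ → List ℕ → Bool
lastOK c []           = true
lastOK c (v ∷ [])     = v ≤ᵇ c
lastOK c (_ ∷ w ∷ vs) = lastOK c (w ∷ vs)

-- coefficient of q^k in Ω_m^{ij}(G[as], q): the number of P-partitions σ
-- with parts ≤ m, σ(b₁) ≤ m+1-i, σ(b_N) ≤ m+1-j and weight k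
omegaCoeff : (m i j : ℕ) → List ℕ → ℕ → ℕ
omegaCoeff m i j as k =
  length (filterᵇ cond (assignments (length bs) m))
  where
  bs = boxes as
  cond : List ℕ → Bool
  cond σ = isPPartition (zip bs σ)
         ∧ headOK (suc m ∸ i) σ
         ∧ lastOK (suc m ∸ j) σ
         ∧ (sum σ ≡ᵇ k)

-- Power series quotient num/den, for den with constant term 1:
-- c₀ = num₀ , c_k = num_k - Σ_{j=1}^{k} den_j c_{k-j}

nth : List ℤ → ℕ → ℤ
nth []       _       = + 0
nth (c ∷ _)  zero    = c
nth (_ ∷ cs) (suc n) = nth cs n

quotCoeffs : (ℕ → ℤ) → (ℕ → ℤ) → ℕ → List ℤ
quotCoeffs num den zero    = num 0 ∷ []
quotCoeffs num den (suc k) =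
  cs ++ (num (suc k) ℤ.- foldr ℤ._+_ (+ 0)
           (map (λ j → den (suc j) ℤ.* nth cs (k ∸ j)) (upTo (suc k))) ∷ [])
  where cs = quotCoeffs num den k

quotCoeff : (ℕ → ℤ) → (ℕ → ℤ) → ℕ → ℤ
quotCoeff num den k = nth (quotCoeffs num den k) k

-- coefficient of q^k in r^q_{i,m} computed from the continued fraction [a₁,…,aₙ]:
-- Ω_m^{m+1-i,1}(G) / Ω_m^{m+1,1}(G)
rCoeffCF : (m i : ℕ) → List ℕ → ℕ → ℤ
rCoeffCF m i as =
  quotCoeff (λ k → + omegaCoeff m (suc m ∸ i) 1 as k)
            (λ k → + omegaCoeff m (suc m) 1 as k)

-- Euclidean algorithm on p / q (fuel-bounded; fuel q+1 always suffices)
cfNat : ℕ → ℕ → ℕ → List ℕ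
cfNat zero     p q       = []
cfNat (suc f)  p zero    = []
cfNat (suc f)  p (suc q) with p % suc q
... | zero  = p / suc q ∷ []
... | suc r = p / suc q ∷ cfNat f (suc q) (suc r)

cfℚ : ℚ → List ℕ
cfℚ y = cfNat (suc (ℚ.↧ₙ y)) ℤ.∣ ℚ.↥ y ∣ (ℚ.↧ₙ y)

rCoeffℚ : (m i : ℕ) → ℚ → ℕ → ℤ
rCoeffℚ m i y = rCoeffCF m i (cfℚ y)

cfPQ : List ℕ → ℕ × ℕ
cfPQ []       = (0 , 1)
cfPQ (a ∷ []) = (a , 1)
cfPQ (a ∷ as) with cfPQ as
... | (p , q) = (a * p + q , p)

-- the value of [a₁,…,aₙ] (all aᵢ ≥ 1, so the denominator is ≥ 1 and
-- suc (q ∸ 1) = q)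
cfValue : List ℕ → ℚ
cfValue as = (+ proj₁ (cfPQ as)) ℚ./ suc (proj₂ (cfPQ as) ∸ 1)

-- n-th prefix [a₁,…,a_{n+1}] of an infinite continued fraction a (a 0 = a₁)
prefix : (ℕ → ℕ) → ℕ → List ℕ
prefix a n = map a (upTo (suc n))

-- y converges to the irrational number x = [a₁,a₂,…], expressed via the
-- convergents xₙ → x:  ∀ ε>0 ∃N ∀n≥N, |yₙ - x| < ε, where |yₙ - x| is
-- witnessed as an eventual bound on |yₙ - x_M|
ConvergesToCF : (ℕ → ℚ) → (ℕ → ℕ) → Set
ConvergesToCF y a =
  (ε : ℚ) → ℚ.0ℚ ℚ.< ε →
  Data.Product.∃ λ N → (n : ℕ) → N ≤ n →
  Data.Product.∃ λ M → (M' : ℕ) → M ≤ M' →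
  ℚ.∣ y n ℚ.- cfValue (prefix a M') ∣ ℚ.< ε

{-# OPTIONS --safe #-}
-- The proof combines two facts.
-- (1) The coefficient of q^k in r^q_{i,m}[a₁,…,aₙ] depends only on a₁,…,a_{k+2}. Reading the
-- strip box by box, the P-partition generating functions arise by iterating a transfer
-- operator on vectors indexed by the value of the current box. If the numerator vector agrees
-- with the denominator vector times a series ρ up to degree j, one more step keeps this and,
-- after correcting one coefficient of ρ, reaches degree j + 1. Hence r ≡ ρ modulo q^(s+1)
-- for every strip whose first s steps are prescribed.
-- (2) If a rational y stays within 1/e of all late convergents of x = [a₁,a₂,…], with e large
-- in terms of a₁,…,a_{L+3}, then the continued fraction of y starts with a₁,…,a_{L+1}: each
-- step of Euclid's algorithm fixes one partial quotient and magnifies the distance by a factor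
-- bounded in terms of the next two. Both yₙ and the convergents xₙ eventually qualify.
module Submission where

open import Defs
open import Data.Nat using (ℕ; _≤_)
open import Data.Integer using (ℤ)
open import Data.Rational using (ℚ; 1ℚ) renaming (_≤_ to _≤ℚ_)
open import Data.Product using (_×_; ∃-syntax)
open import Relation.Binary.PropositionalEquality using (_≡_)

module ListPrefix where

  open import Data.Nat using (z≤n; s≤s)
  open import Data.List using (List; []; _∷_; _++_; replicate)
  import Data.List.Properties as List
  open import Data.Product using (∃; _,_)
  open import Relation.Binary.PropositionalEquality

  infix 4 _⊑_
  _⊑_ : {A : Set} → List A → List A → Set
  xs ⊑ ys = ∃ λ rest → ys ≡ xs ++ rest

  ⊑-refl : ∀ {A : Set} (xs : List A) → xs ⊑ xs
  ⊑-refl xs = [] , sym (List.++-identityʳ xs)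

  ⊑-++ʳ : ∀ {A : Set} {xs ys : List A} zs → xs ⊑ ys → xs ⊑ ys ++ zs
  ⊑-++ʳ {xs = xs} zs (rest , refl) = rest ++ zs , List.++-assoc xs rest zs

  ++⁺-⊑ : ∀ {A : Set} (zs : List A) {xs ys} → xs ⊑ ys → zs ++ xs ⊑ zs ++ ys
  ++⁺-⊑ zs {xs} (rest , refl) = rest , sym (List.++-assoc zs xs rest)

  replicate-⊑ : ∀ {A : Set} (x : A) {a b} → a ≤ b → replicate a x ⊑ replicate b x
  replicate-⊑ x {b = b} z≤n     = replicate b x , refl
  replicate-⊑ x         (s≤s a≤b) with replicate-⊑ x a≤b
  ... | rest , eq = rest , cong (x ∷_) eq

module PowerSeries where

  open import Data.Nat as ℕ using (zero; suc; _∸_; _<_; s≤s)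
  import Data.Nat.Properties as ℕ
  open import Data.Nat.Induction using (<-rec)
  open import Data.Integer as ℤ using (+_; 0ℤ; 1ℤ; _+_; _*_; _-_)
  import Data.Integer.Properties as ℤ
  open import Data.Integer.Tactic.RingSolver using (solve-∀)
  open import Data.Fin using (Fin; toℕ)
  import Data.Fin.Properties as Fin
  open import Data.Bool using (Bool; true; false; if_then_else_)
  open import Data.List as List using (List; []; _∷_; _++_; map; applyUpTo; upTo; foldr; length; filterᵇ)
  import Data.List.Properties as List
  open import Data.Sum using (inj₁; inj₂)
  open import Function using (_∘_; id)
  open import Relation.Binary.PropositionalEquality
  open import Algebra.Properties.Semiring.Sum ℤ.+-*-semiring
    using (sum-syntax; sum-cong-≗; sum-replicate-zero; ∑-distrib-+; ∑-comm; *-distribʳ-sum)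

  Series : Set
  Series = ℕ → ℤ

  infixl 7 _⋆_
  _⋆_ : Series → Series → Series
  (f ⋆ g) n = ∑[ j < suc n ] (f (toℕ j) * g (n ∸ toℕ j))

  shift : ℕ → Series → Series
  shift zero    g n       = g n
  shift (suc v) g zero    = 0ℤ
  shift (suc v) g (suc n) = shift v g n

  sum-zero : ∀ n {f : Fin n → ℤ} → (∀ j → f j ≡ 0ℤ) → ∑[ j < n ] f j ≡ 0ℤ
  sum-zero n f≗0 = trans (sum-cong-≗ f≗0) (sum-replicate-zero n)

  ⋆-zeroˡ : ∀ ρ n → ((λ _ → 0ℤ) ⋆ ρ) n ≡ 0ℤ
  ⋆-zeroˡ ρ n = sum-zero (suc n) (λ j → ℤ.*-zeroˡ (ρ (n ∸ toℕ j)))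

  ⋆-shiftˡ : ∀ v g ρ n → (shift v g ⋆ ρ) n ≡ shift v (g ⋆ ρ) n
  ⋆-shiftˡ zero    g ρ n       = refl
  ⋆-shiftˡ (suc v) g ρ zero    = ℤ.*-zeroˡ (ρ 0)
  ⋆-shiftˡ (suc v) g ρ (suc n) = trans (ℤ.+-identityˡ _) (⋆-shiftˡ v g ρ n)

  ⋆-sumˡ : ∀ M (G : Fin M → Series) ρ n → ((λ t → ∑[ v < M ] G v t) ⋆ ρ) n ≡ ∑[ v < M ] (G v ⋆ ρ) n
  ⋆-sumˡ M G ρ n = trans (sum-cong-≗ {suc n} (λ j → *-distribʳ-sum (ρ (n ∸ toℕ j)) (λ v → G v (toℕ j))))
                         (∑-comm {suc n} {M} (λ j v → G v (toℕ j) * ρ (n ∸ toℕ j)))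

  ⋆-congˡ : ∀ {f f'} ρ n → (∀ t → t ≤ n → f t ≡ f' t) → (f ⋆ ρ) n ≡ (f' ⋆ ρ) n
  ⋆-congˡ ρ n f≗f' = sum-cong-≗ {suc n} (λ j → cong (_* ρ (n ∸ toℕ j)) (f≗f' (toℕ j) (Fin.toℕ≤pred[n] j)))

  ⋆-congʳ : ∀ f {ρ ρ'} n → (∀ t → t ≤ n → ρ t ≡ ρ' t) → (f ⋆ ρ) n ≡ (f ⋆ ρ') n
  ⋆-congʳ f n ρ≗ρ' = sum-cong-≗ {suc n} (λ j → cong (f (toℕ j) *_) (ρ≗ρ' (n ∸ toℕ j) (ℕ.m∸n≤m n (toℕ j))))

  shift-cong : ∀ v {g h} n → (∀ t → t ℕ.+ v ≡ n → g t ≡ h t) → shift v g n ≡ shift v h n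
  shift-cong zero    n       g≗h = g≗h n (ℕ.+-identityʳ n)
  shift-cong (suc v) zero    g≗h = refl
  shift-cong (suc v) (suc n) g≗h = shift-cong v n (λ t eq → g≗h t (trans (ℕ.+-suc t v) (cong suc eq)))

  shift-sum : ∀ k M (G : Fin M → Series) n → shift k (λ t → ∑[ v < M ] G v t) n ≡ ∑[ v < M ] shift k (G v) n
  shift-sum zero    M G n       = refl
  shift-sum (suc k) M G zero    = sym (sum-zero M (λ _ → refl))
  shift-sum (suc k) M G (suc n) = shift-sum k M G n

  shift-shift : ∀ k v g n → shift k (shift v g) n ≡ shift (v ℕ.+ k) g n
  shift-shift zero    v g n       rewrite ℕ.+-identityʳ v = refl
  shift-shift (suc k) v g zero    rewrite ℕ.+-suc v k = refl
  shift-shift (suc k) v g (suc n) rewrite ℕ.+-suc v k = shift-shift k v g n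

  shift-zero : ∀ k n → shift k (λ _ → 0ℤ) n ≡ 0ℤ
  shift-zero zero    n       = refl
  shift-zero (suc k) zero    = refl
  shift-zero (suc k) (suc n) = shift-zero k n

  ∑ₗ : {A : Set} → List A → (A → ℤ) → ℤ
  ∑ₗ xs f = foldr _+_ 0ℤ (map f xs)

  ∑ₗ-++ : ∀ {A : Set} (xs ys : List A) f → ∑ₗ (xs ++ ys) f ≡ ∑ₗ xs f + ∑ₗ ys f
  ∑ₗ-++ []       ys f = sym (ℤ.+-identityˡ _)
  ∑ₗ-++ (x ∷ xs) ys f = trans (cong (_+_ (f x)) (∑ₗ-++ xs ys f)) (sym (ℤ.+-assoc (f x) _ _))

  ∑ₗ-map : ∀ {A B : Set} (h : A → B) xs f → ∑ₗ (map h xs) f ≡ ∑ₗ xs (f ∘ h)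
  ∑ₗ-map h xs f = cong (foldr _+_ 0ℤ) (sym (List.map-∘ xs))

  ∑ₗ-concatMap : ∀ {A B : Set} (h : A → List B) xs f → ∑ₗ (List.concatMap h xs) f ≡ ∑ₗ xs (λ x → ∑ₗ (h x) f)
  ∑ₗ-concatMap h []       f = refl
  ∑ₗ-concatMap h (x ∷ xs) f = trans (∑ₗ-++ (h x) (List.concatMap h xs) f) (cong (_+_ (∑ₗ (h x) f)) (∑ₗ-concatMap h xs f))

  ∑ₗ-∑-comm : ∀ {A : Set} (xs : List A) n (g : A → Fin n → ℤ) →
              ∑ₗ xs (λ x → ∑[ j < n ] g x j) ≡ ∑[ j < n ] ∑ₗ xs (λ x → g x j)
  ∑ₗ-∑-comm []       n g = sym (sum-zero n (λ _ → refl))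
  ∑ₗ-∑-comm (x ∷ xs) n g = trans (cong (_+_ (∑[ j < n ] g x j)) (∑ₗ-∑-comm xs n g)) (sym (∑-distrib-+ (g x) _))

  length-filterᵇ : ∀ {A : Set} (P : A → Bool) xs → + length (filterᵇ P xs) ≡ ∑ₗ xs (λ x → if P x then 1ℤ else 0ℤ)
  length-filterᵇ P []       = refl
  length-filterᵇ P (x ∷ xs) with P x
  ... | true  = cong (_+_ 1ℤ) (length-filterᵇ P xs)
  ... | false = trans (length-filterᵇ P xs) (sym (ℤ.+-identityˡ _))

  ∑ₗ-applyUpTo : ∀ (g : ℕ → ℕ) n (f : ℕ → ℤ) → ∑ₗ (applyUpTo g n) f ≡ ∑[ j < n ] f (g (toℕ j))
  ∑ₗ-applyUpTo g zero    f = refl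
  ∑ₗ-applyUpTo g (suc n) f = cong (_+_ (f (g 0))) (∑ₗ-applyUpTo (g ∘ suc) n f)

  ∑ₗ-upTo : ∀ n (f : ℕ → ℤ) → ∑ₗ (upTo n) f ≡ ∑[ j < n ] f (toℕ j)
  ∑ₗ-upTo = ∑ₗ-applyUpTo id

  nth-++ˡ : ∀ (cs ys : List ℤ) t → t < length cs → nth (cs ++ ys) t ≡ nth cs t
  nth-++ˡ (c ∷ cs) ys zero    _         = refl
  nth-++ˡ (c ∷ cs) ys (suc t) (s≤s t<n) = nth-++ˡ cs ys t t<n

  nth-last : ∀ (cs : List ℤ) x → nth (cs ++ x ∷ []) (length cs) ≡ x
  nth-last []       x = refl
  nth-last (c ∷ cs) x = nth-last cs x

  module _ (num den : Series) where

    length-quotCoeffs : ∀ k → length (quotCoeffs num den k) ≡ suc k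
    length-quotCoeffs zero    = refl
    length-quotCoeffs (suc k) =
      trans (List.length-++ (quotCoeffs num den k)) (trans (cong (ℕ._+ 1) (length-quotCoeffs k)) (ℕ.+-comm (suc k) 1))

    nth-quotCoeffs : ∀ k t → t ≤ k → nth (quotCoeffs num den k) t ≡ quotCoeff num den t
    nth-quotCoeffs k t t≤k with ℕ.m≤n⇒m<n∨m≡n t≤k
    ... | inj₂ refl = refl
    nth-quotCoeffs (suc k) t _ | inj₁ (s≤s t≤k) =
      trans (nth-++ˡ (quotCoeffs num den k) _ t (subst (t <_) (sym (length-quotCoeffs k)) (s≤s t≤k)))
            (nth-quotCoeffs k t t≤k)

    quotCoeff-suc : ∀ k → quotCoeff num den (suc k) ≡
                    num (suc k) - ∑[ j < suc k ] (den (suc (toℕ j)) * quotCoeff num den (k ∸ toℕ j))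
    quotCoeff-suc k = begin
        nth (cs ++ c ∷ []) (suc k)
      ≡⟨ cong (nth (cs ++ c ∷ [])) (sym (length-quotCoeffs k)) ⟩
        nth (cs ++ c ∷ []) (length cs)
      ≡⟨ nth-last cs c ⟩
        num (suc k) - ∑ₗ (upTo (suc k)) (λ j → den (suc j) * nth cs (k ∸ j))
      ≡⟨ cong (λ s → num (suc k) - s) (∑ₗ-upTo (suc k) (λ j → den (suc j) * nth cs (k ∸ j))) ⟩
        num (suc k) - ∑[ j < suc k ] (den (suc (toℕ j)) * nth cs (k ∸ toℕ j))
      ≡⟨ cong (λ s → num (suc k) - s) (sum-cong-≗ {suc k} (λ j →
           cong (den (suc (toℕ j)) *_) (nth-quotCoeffs k (k ∸ toℕ j) (ℕ.m∸n≤m k (toℕ j))))) ⟩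
        num (suc k) - ∑[ j < suc k ] (den (suc (toℕ j)) * quotCoeff num den (k ∸ toℕ j))
      ∎
      where
      open ≡-Reasoning
      cs : List ℤ
      cs = quotCoeffs num den k
      c : ℤ
      c = num (suc k) - ∑ₗ (upTo (suc k)) (λ j → den (suc j) * nth cs (k ∸ j))

    quotCoeff-unique : ∀ (ρ : Series) K → den 0 ≡ 1ℤ → (∀ n → n ≤ K → num n ≡ (den ⋆ ρ) n) →
                       ∀ n → n ≤ K → quotCoeff num den n ≡ ρ n
    quotCoeff-unique ρ K den₀≡1 num≡den⋆ρ = <-rec _ go
      where
      cancel : ∀ r s → (1ℤ * r + s) - s ≡ r
      cancel = solve-∀
      go : ∀ n → (∀ {t} → t < n → t ≤ K → quotCoeff num den t ≡ ρ t) → n ≤ K → quotCoeff num den n ≡ ρ n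
      go zero    _  0≤K = begin
        num 0                ≡⟨ num≡den⋆ρ 0 0≤K ⟩
        den 0 * ρ 0 + 0ℤ     ≡⟨ cong (λ d → d * ρ 0 + 0ℤ) den₀≡1 ⟩
        1ℤ * ρ 0 + 0ℤ        ≡⟨ trans (ℤ.+-identityʳ _) (ℤ.*-identityˡ (ρ 0)) ⟩
        ρ 0                  ∎
        where open ≡-Reasoning
      go (suc n) ih n<K = begin
        quotCoeff num den (suc n)                               ≡⟨ quotCoeff-suc n ⟩
        num (suc n) - ∑[ j < suc n ] (den (suc (toℕ j)) * quotCoeff num den (n ∸ toℕ j))
          ≡⟨ cong₂ _-_ (num≡den⋆ρ (suc n) n<K) (sum-cong-≗ {suc n} (λ j → cong (den (suc (toℕ j)) *_)
               (ih (s≤s (ℕ.m∸n≤m n (toℕ j))) (ℕ.≤-trans (ℕ.m∸n≤m n (toℕ j)) (ℕ.<⇒≤ n<K))))) ⟩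
        (den 0 * ρ (suc n) + S) - S                             ≡⟨ cong (λ d → (d * ρ (suc n) + S) - S) den₀≡1 ⟩
        (1ℤ * ρ (suc n) + S) - S                                ≡⟨ cancel (ρ (suc n)) S ⟩
        ρ (suc n)                                               ∎
        where
        open ≡-Reasoning
        S : ℤ
        S = ∑[ j < suc n ] (den (suc (toℕ j)) * ρ (n ∸ toℕ j))

module WalkPPartition where

  open import Data.Nat as ℕ using (suc; _≤ᵇ_; _≡ᵇ_)
  import Data.Nat.Properties as ℕ
  open import Data.Bool using (Bool; true; false; T; _∧_; _∨_; not)
  open import Data.Bool.Properties using (T-∧; T-≡; ⇔→≡)
  open import Data.Empty using (⊥-elim)
  open import Data.List using (List; []; _∷_; zip; length)
  open import Data.List.Relation.Unary.All as All using (All; []; _∷_)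
  open import Data.Product using (Σ; _,_; proj₁; proj₂)
  open import Function using (_∘_; id; _⇔_; mk⇔; Equivalence)
  open import Relation.Binary.PropositionalEquality
  open Equivalence using (to; from)

  _≼_ : ℕ × ℕ → ℕ × ℕ → Set
  (x , y) ≼ (x' , y') = x ≤ x' × y ≤ y'

  ≼-refl : ∀ p → p ≼ p
  ≼-refl (x , y) = ℕ.≤-refl , ℕ.≤-refl

  ≼-trans : ∀ p q r → p ≼ q → q ≼ r → p ≼ r
  ≼-trans (x , y) (x' , y') (x'' , y'') (x≤ , y≤) (x'≤ , y'≤) = ℕ.≤-trans x≤ x'≤ , ℕ.≤-trans y≤ y'≤

  ≼-move : ∀ d p → p ≼ move d p
  ≼-move U (x , y) = ℕ.≤-refl , ℕ.n≤1+n y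
  ≼-move R (x , y) = ℕ.n≤1+n x , ℕ.≤-refl

  Labelled : Set
  Labelled = (ℕ × ℕ) × ℕ

  Ordered : Labelled → Labelled → Set
  Ordered ((x , y) , v) ((x' , y') , v') = (y ≡ y' → x ≤ x' → v ≤ v') × (x ≡ x' → y' ≤ y → v ≤ v')

  Ordered-refl : ∀ b → Ordered b b
  Ordered-refl b = (λ _ _ → ℕ.≤-refl) , (λ _ _ → ℕ.≤-refl)

  IsPPartition : List Labelled → Set
  IsPPartition bs = All (λ b → All (Ordered b) bs) bs

  IsPPartition-∷ : ∀ {h t} → IsPPartition t → All (Ordered h) t → All (λ b → Ordered b h) t → IsPPartition (h ∷ t)
  IsPPartition-∷ {h} pp row column = (Ordered-refl h ∷ row) ∷ All.zipWith (λ (c , r) → c ∷ r) (column , pp)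

  IsPPartition-head : ∀ {h t} → IsPPartition (h ∷ t) → All (Ordered h) (h ∷ t) × All (λ b → Ordered b h) (h ∷ t)
  IsPPartition-head pp = All.head pp , All.map All.head pp

  IsPPartition-tail : ∀ {h t} → IsPPartition (h ∷ t) → IsPPartition t
  IsPPartition-tail (_ ∷ pp) = All.map All.tail pp

  T-≡ᵇ : ∀ m n → T (m ≡ᵇ n) ⇔ m ≡ n
  T-≡ᵇ m n = mk⇔ (ℕ.≡ᵇ⇒≡ m n) (ℕ.≡⇒≡ᵇ m n)

  T-≤ᵇ : ∀ m n → T (m ≤ᵇ n) ⇔ m ≤ n
  T-≤ᵇ m n = mk⇔ (ℕ.≤ᵇ⇒≤ m n) ℕ.≤⇒≤ᵇ

  T-implies : ∀ {a b c} {A B C : Set} → T a ⇔ A → T b ⇔ B → T c ⇔ C → T (not (a ∧ b) ∨ c) ⇔ (A → B → C)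
  T-implies {a} {b} {c} a⇔A b⇔B c⇔C =
    mk⇔ (λ t α β → to c⇔C (sound a b t (from a⇔A α) (from b⇔B β)))
        (λ f → complete a b (λ ta tb → from c⇔C (f (to a⇔A ta) (to b⇔B tb))))
    where
    sound : ∀ a b → T (not (a ∧ b) ∨ c) → T a → T b → T c
    sound true true t _ _ = t
    complete : ∀ a b → (T a → T b → T c) → T (not (a ∧ b) ∨ c)
    complete true  true  f = f _ _
    complete true  false f = _
    complete false b     f = _

  T-pairOK : ∀ b b' → T (pairOK b b') ⇔ Ordered b b'
  T-pairOK ((x , y) , v) ((x' , y') , v') =
    mk⇔ (λ t → let r , c = to T-∧ t in to row r , to column c)
        (λ (r , c) → from T-∧ (from row r , from column c))
    where
    row : T (not ((y ≡ᵇ y') ∧ (x ≤ᵇ x')) ∨ (v ≤ᵇ v')) ⇔ (y ≡ y' → x ≤ x' → v ≤ v')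
    row = T-implies (T-≡ᵇ y y') (T-≤ᵇ x x') (T-≤ᵇ v v')
    column : T (not ((x ≡ᵇ x') ∧ (y' ≤ᵇ y)) ∨ (v ≤ᵇ v')) ⇔ (x ≡ x' → y' ≤ y → v ≤ v')
    column = T-implies (T-≡ᵇ x x') (T-≤ᵇ y' y) (T-≤ᵇ v v')

  T-allB : ∀ {A : Set} (p : A → Bool) xs → T (allB p xs) ⇔ All (T ∘ p) xs
  T-allB p []       = mk⇔ (λ _ → []) (λ _ → _)
  T-allB p (x ∷ xs) =
    mk⇔ (λ t → let px , pxs = to T-∧ t in px ∷ to (T-allB p xs) pxs)
        (λ { (px ∷ pxs) → from T-∧ (px , from (T-allB p xs) pxs) })

  T-isPPartition : ∀ bs → T (isPPartition bs) ⇔ IsPPartition bs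
  T-isPPartition bs =
    mk⇔ (λ t → All.map (λ {b} tb → All.map (to (T-pairOK b _)) (to (T-allB (pairOK b) bs) tb))
                       (to (T-allB _ bs) t))
        (λ pp → from (T-allB _ bs)
                  (All.map (λ {b} row → from (T-allB (pairOK b) bs) (All.map (from (T-pairOK b _)) row)) pp))

  stepOK : Dir → ℕ → ℕ → Bool
  stepOK U v w = w ≤ᵇ v
  stepOK R v w = v ≤ᵇ w

  head₀ : List ℕ → ℕ
  head₀ []      = 0
  head₀ (v ∷ _) = v

  monotoneAlong : List Dir → List ℕ → Bool
  monotoneAlong []      _       = true
  monotoneAlong (d ∷ s) []      = true
  monotoneAlong (d ∷ s) (v ∷ σ) = stepOK d v (head₀ σ) ∧ monotoneAlong s σ

  zip-walk : ∀ p s w σ → Σ (List Labelled) λ rest → zip (walk p s) (w ∷ σ) ≡ (p , w) ∷ rest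
  zip-walk p []      w σ = _ , refl
  zip-walk p (d ∷ s) w σ = _ , refl

  zip-walk-above : ∀ p s (σ : List ℕ) → All (λ b → p ≼ proj₁ b) (zip (walk p s) σ)
  zip-walk-above p []      []      = []
  zip-walk-above p []      (w ∷ σ) = ≼-refl p ∷ []
  zip-walk-above p (d ∷ s) []      = []
  zip-walk-above p (d ∷ s) (w ∷ σ) =
    ≼-refl p ∷ All.map (λ {b} → ≼-trans p (move d p) (proj₁ b) (≼-move d p)) (zip-walk-above (move d p) s σ)

  ordered⇒stepOK : ∀ d p v w → Ordered (p , v) (move d p , w) → Ordered (move d p , w) (p , v) → T (stepOK d v w)
  ordered⇒stepOK R (x , y) v w (row , _) _        = ℕ.≤⇒≤ᵇ (row refl (ℕ.n≤1+n x))
  ordered⇒stepOK U (x , y) v w _        (_ , col) = ℕ.≤⇒≤ᵇ (col refl (ℕ.n≤1+n y))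

  ordered-via-next : ∀ d p v w b → T (stepOK d v w) → move d p ≼ proj₁ b →
                     Ordered (move d p , w) b → Ordered b (move d p , w) → Ordered (p , v) b × Ordered b (p , v)
  ordered-via-next R (x , y) v w ((x' , y') , v') v≤w (x<x' , _) (row , _) _ =
    ((λ y≡y' _ → ℕ.≤-trans (ℕ.≤ᵇ⇒≤ v w v≤w) (row y≡y' x<x')) , (λ x≡x' _ → ⊥-elim (ℕ.<⇒≢ x<x' x≡x')))
    , ((λ _ x'≤x → ⊥-elim (ℕ.<⇒≱ x<x' x'≤x)) , (λ x'≡x _ → ⊥-elim (ℕ.<⇒≢ x<x' (sym x'≡x))))
  ordered-via-next U (x , y) v w ((x' , y') , v') w≤v (_ , y<y') _ (_ , col) =
    ((λ y≡y' _ → ⊥-elim (ℕ.<⇒≢ y<y' y≡y')) , (λ _ y'≤y → ⊥-elim (ℕ.<⇒≱ y<y' y'≤y)))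
    , ((λ y'≡y _ → ⊥-elim (ℕ.<⇒≢ y<y' (sym y'≡y))) , (λ x'≡x _ → ℕ.≤-trans (col x'≡x y<y') (ℕ.≤ᵇ⇒≤ w v w≤v)))

  IsPPartition⇒monotoneAlong : ∀ p s σ → length σ ≡ suc (length s) →
                               IsPPartition (zip (walk p s) σ) → T (monotoneAlong s σ)
  IsPPartition⇒monotoneAlong p []      (v ∷ [])     _   _  = _
  IsPPartition⇒monotoneAlong p (d ∷ s) (v ∷ w ∷ σ) len pp with zip-walk (move d p) s w σ
  ... | rest , eq = from T-∧ (ordered⇒stepOK d p v w (All.head (All.tail (All.head pp')))
                                                      (All.head (All.head (All.tail pp')))
                            , IsPPartition⇒monotoneAlong (move d p) s (w ∷ σ) (ℕ.suc-injective len) (IsPPartition-tail pp))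
    where
    pp' : IsPPartition ((p , v) ∷ (move d p , w) ∷ rest)
    pp' = subst (λ bs → IsPPartition ((p , v) ∷ bs)) eq pp

  monotoneAlong⇒IsPPartition : ∀ p s σ → length σ ≡ suc (length s) →
                               T (monotoneAlong s σ) → IsPPartition (zip (walk p s) σ)
  monotoneAlong⇒IsPPartition p []      (v ∷ [])     _   _ = (Ordered-refl (p , v) ∷ []) ∷ []
  monotoneAlong⇒IsPPartition p (d ∷ s) (v ∷ w ∷ σ) len t =
    IsPPartition-∷ pp (All.map proj₁ both) (All.map proj₂ both)
    where
    p' : ℕ × ℕ
    p' = move d p
    bs : List Labelled
    bs = zip (walk p' s) (w ∷ σ)
    pp : IsPPartition bs
    pp = monotoneAlong⇒IsPPartition p' s (w ∷ σ) (ℕ.suc-injective len) (proj₂ (to T-∧ t))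
    heads : All (Ordered (p' , w)) bs × All (λ b → Ordered b (p' , w)) bs
    heads with zip-walk p' s w σ
    ... | rest , eq = subst (λ bs → All (Ordered (p' , w)) bs × All (λ b → Ordered b (p' , w)) bs) (sym eq)
                            (IsPPartition-head (subst IsPPartition eq pp))
    both : All (λ b → Ordered (p , v) b × Ordered b (p , v)) bs
    both = All.zipWith (λ {b} ((above , r) , c) → ordered-via-next d p v w b (proj₁ (to T-∧ t)) above r c)
             (All.zipWith id (zip-walk-above p' s (w ∷ σ) , proj₁ heads) , proj₂ heads)

  isPPartition-walk : ∀ p s σ → length σ ≡ suc (length s) → isPPartition (zip (walk p s) σ) ≡ monotoneAlong s σ
  isPPartition-walk p s σ len = ⇔→≡ {z = true} (mk⇔
    (to T-≡ ∘ IsPPartition⇒monotoneAlong p s σ len ∘ to (T-isPPartition _) ∘ from T-≡)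
    (to T-≡ ∘ from (T-isPPartition _) ∘ monotoneAlong⇒IsPPartition p s σ len ∘ from T-≡))

module TransferMatrix (m : ℕ) where

  open ListPrefix
  open PowerSeries
  open WalkPPartition
  open import Data.Nat as ℕ using (zero; suc; _∸_; _<_; z≤n; s≤s; _≤ᵇ_; _≡ᵇ_)
  import Data.Nat.Properties as ℕ
  open import Data.Nat.ListAction using (sum)
  open import Data.Integer as ℤ using (+_; 0ℤ; 1ℤ; _+_; _*_; _-_)
  import Data.Integer.Properties as ℤ
  open import Data.Integer.Tactic.RingSolver using (solve-∀)
  open import Data.Fin using (Fin; toℕ)
  import Data.Fin.Properties as Fin
  open import Data.Bool using (Bool; true; false; if_then_else_; _∧_)
  open import Data.Bool.Properties using (∧-zeroʳ; T-≡)
  open import Data.List using (List; []; _∷_; _++_; length; foldl; foldr; map; upTo; concatMap; filterᵇ; zip)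
  open import Data.List.Properties using (foldl-++; map-cong)
  open import Data.List.Relation.Unary.All using (All; []; _∷_)
  open import Data.Product using (∃; _,_)
  open import Data.Sum using (inj₁; inj₂)
  open import Function using (Equivalence)
  open import Relation.Nullary.Decidable using (does; dec-true; dec-false)
  open import Relation.Binary.PropositionalEquality
  open import Algebra.Properties.Semiring.Sum ℤ.+-*-semiring using (sum-syntax; sum-cong-≗)

  -- run (initial c) s v is the generating function of the P-partitions of the walk s with first
  -- value ≤ c and last value v, weighted by all boxes but the last.
  State : Set
  State = ℕ → Series

  gate : Bool → Series → Series
  gate b g = if b then g else (λ _ → 0ℤ)

  step : Dir → State → State
  step d f u n = ∑[ v < suc m ] gate (stepOK d (toℕ v) u) (shift (toℕ v) (f (toℕ v))) n

  run : State → List Dir → State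
  run = foldl (λ f d → step d f)

  total : State → Series
  total f n = ∑[ v < suc m ] shift (toℕ v) (f (toℕ v)) n

  initial : ℕ → State
  initial c v zero    = if v ≤ᵇ c then 1ℤ else 0ℤ
  initial c v (suc n) = 0ℤ

  record Agree (j : ℕ) (ρ : Series) (f g : State) : Set where
    constructor agree
    field coeff : ∀ v n → n ℕ.+ v < j → f v n ≡ (g v ⋆ ρ) n
  open Agree

  module _ {j ρ f g} (f≈gρ : Agree j ρ f g) where

    shift-agree : ∀ v n → n < j → shift v (f v) n ≡ (shift v (g v) ⋆ ρ) n
    shift-agree v n n<j = trans (shift-cong v n (λ t t+v≡n → coeff f≈gρ v t (subst (_< j) (sym t+v≡n) n<j)))
                                (sym (⋆-shiftˡ v (g v) ρ n))

    step-agree : ∀ d u n → n < j → step d f u n ≡ (step d g u ⋆ ρ) n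
    step-agree d u n n<j = trans (sum-cong-≗ {suc m} (λ v → gated v (stepOK d (toℕ v) u)))
                                 (sym (⋆-sumˡ (suc m) (λ v → gate (stepOK d (toℕ v) u) (shift (toℕ v) (g (toℕ v)))) ρ n))
      where
      gated : ∀ v b → gate b (shift (toℕ v) (f (toℕ v))) n ≡ (gate b (shift (toℕ v) (g (toℕ v))) ⋆ ρ) n
      gated v true  = shift-agree (toℕ v) n n<j
      gated v false = sym (⋆-zeroˡ ρ n)

    total-agree : ∀ n → n < j → total f n ≡ (total g ⋆ ρ) n
    total-agree n n<j = trans (sum-cong-≗ {suc m} (λ v → shift-agree (toℕ v) n n<j))
                              (sym (⋆-sumˡ (suc m) (λ v → shift (toℕ v) (g (toℕ v))) ρ n))

    agree-step : ∀ d → Agree j ρ (step d f) (step d g)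
    agree-step d = agree λ u n n+u<j → step-agree d u n (ℕ.≤-<-trans (ℕ.m≤m+n n u) n+u<j)

  step-normalised : ∀ d g → g 0 0 ≡ 1ℤ → step d g 0 0 ≡ 1ℤ
  step-normalised d g g₀₀≡1 = trans (cong₂ _+_ (first d) (sum-zero m (λ v → later (stepOK d (suc (toℕ v)) 0))))
                                    (trans (ℤ.+-identityʳ _) g₀₀≡1)
    where
    first : ∀ d → gate (stepOK d 0 0) (shift 0 (g 0)) 0 ≡ g 0 0
    first U = refl
    first R = refl
    later : ∀ {v} b → gate b (shift (suc v) (g (suc v))) 0 ≡ 0ℤ
    later true  = refl
    later false = refl

  run-normalised : ∀ s g → g 0 0 ≡ 1ℤ → run g s 0 0 ≡ 1ℤ
  run-normalised []      g g₀₀≡1 = g₀₀≡1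
  run-normalised (d ∷ s) g g₀₀≡1 = run-normalised s (step d g) (step-normalised d g g₀₀≡1)

  total-normalised : ∀ g → g 0 0 ≡ 1ℤ → total g 0 ≡ 1ℤ
  total-normalised g g₀₀≡1 = trans (cong₂ _+_ g₀₀≡1 (sum-zero m (λ _ → refl))) (ℤ.+-identityʳ 1ℤ)

  correct : ℕ → ℤ → Series → Series
  correct j δ ρ t = if does (t ℕ.≟ j) then ρ t + δ else ρ t

  correct-< : ∀ j δ ρ t → t < j → correct j δ ρ t ≡ ρ t
  correct-< j δ ρ t t<j rewrite dec-false (t ℕ.≟ j) (ℕ.<⇒≢ t<j) = refl

  correct-≡ : ∀ j δ ρ → correct j δ ρ j ≡ ρ j + δ
  correct-≡ j δ ρ rewrite dec-true (j ℕ.≟ j) refl = refl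

  ⋆-correct : ∀ g j δ ρ → (g ⋆ correct j δ ρ) j ≡ (g ⋆ ρ) j + g 0 * δ
  ⋆-correct g j δ ρ = begin
      g 0 * correct j δ ρ j + S'
    ≡⟨ cong₂ (λ r s → g 0 * r + s) (correct-≡ j δ ρ) earlier ⟩
      g 0 * (ρ j + δ) + S
    ≡⟨ regroup (g 0) (ρ j) δ S ⟩
      (g 0 * ρ j + S) + g 0 * δ
    ∎
    where
    open ≡-Reasoning
    S' S : ℤ
    S' = ∑[ t < j ] (g (suc (toℕ t)) * correct j δ ρ (j ∸ suc (toℕ t)))
    S  = ∑[ t < j ] (g (suc (toℕ t)) * ρ (j ∸ suc (toℕ t)))
    regroup : ∀ a r d s → a * (r + d) + s ≡ (a * r + s) + a * d
    regroup = solve-∀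
    earlier : S' ≡ S
    earlier = sum-cong-≗ {j} (λ t → cong (g (suc (toℕ t)) *_)
                (correct-< j δ ρ _ (ℕ.∸-monoʳ-< {j} {suc (toℕ t)} {0} (s≤s z≤n) (Fin.toℕ<n t))))

  -- A step makes every component exact below degree j, while component u only has to be exact
  -- below degree j + 1 ∸ u. The one missing coefficient, degree j of component 0, is matched by
  -- correcting ρ at degree j, as component 0 of the denominator has constant term 1.
  agree-step-refine : ∀ {j ρ f g} d → g 0 0 ≡ 1ℤ → Agree j ρ f g →
                   Agree (suc j) (correct j (step d f 0 j - (step d g 0 ⋆ ρ) j) ρ) (step d f) (step d g)
  agree-step-refine {j} {ρ} {f} {g} d g₀₀≡1 f≈gρ = agree coeff′
    where
    δ : ℤ
    δ = step d f 0 j - (step d g 0 ⋆ ρ) j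
    ρ' : Series
    ρ' = correct j δ ρ
    below : ∀ u n → n < j → step d f u n ≡ (step d g u ⋆ ρ') n
    below u n n<j = trans (step-agree f≈gρ d u n n<j)
                          (⋆-congʳ (step d g u) n (λ t t≤n → sym (correct-< j δ ρ t (ℕ.≤-<-trans t≤n n<j))))
    cancel : ∀ a x → a + 1ℤ * (x - a) ≡ x
    cancel = solve-∀
    at : step d f 0 j ≡ (step d g 0 ⋆ ρ') j
    at = sym (begin
      (step d g 0 ⋆ ρ') j                   ≡⟨ ⋆-correct (step d g 0) j δ ρ ⟩
      (step d g 0 ⋆ ρ) j + step d g 0 0 * δ ≡⟨ cong (λ c → (step d g 0 ⋆ ρ) j + c * δ) (step-normalised d g g₀₀≡1) ⟩
      (step d g 0 ⋆ ρ) j + 1ℤ * δ          ≡⟨ cancel ((step d g 0 ⋆ ρ) j) (step d f 0 j) ⟩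
      step d f 0 j                          ∎)
      where open ≡-Reasoning
    coeff′ : ∀ u n → n ℕ.+ u < suc j → step d f u n ≡ (step d g u ⋆ ρ') n
    coeff′ (suc u) n n+u<1+j = below (suc u) n (ℕ.<-≤-trans (ℕ.m<m+n n (s≤s z≤n)) (ℕ.≤-pred n+u<1+j))
    coeff′ zero    n n+0<1+j with ℕ.m≤n⇒m<n∨m≡n (ℕ.≤-pred (subst (_< suc j) (ℕ.+-identityʳ n) n+0<1+j))
    ... | inj₁ n<j  = below zero n n<j
    ... | inj₂ refl = at

  agree-run : ∀ s {j ρ f g} → Agree j ρ f g → Agree j ρ (run f s) (run g s)
  agree-run []      f≈gρ = f≈gρ
  agree-run (d ∷ s) f≈gρ = agree-run s (agree-step f≈gρ d)

  agree-run-refine : ∀ s {j ρ f g} → g 0 0 ≡ 1ℤ → Agree j ρ f g →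
                  ∃ λ ρ' → Agree (j ℕ.+ length s) ρ' (run f s) (run g s)
  agree-run-refine []      {j} {ρ} {f} {g} _ f≈gρ = ρ , subst (λ j' → Agree j' ρ f g) (sym (ℕ.+-identityʳ j)) f≈gρ
  agree-run-refine (d ∷ s) {j} {f = f} {g} g₀₀≡1 f≈gρ
    with agree-run-refine s (step-normalised d g g₀₀≡1) (agree-step-refine d g₀₀≡1 f≈gρ)
  ... | ρ' , f≈gρ' = ρ' , subst (λ j' → Agree j' ρ' (run (step d f) s) (run (step d g) s)) (sym (ℕ.+-suc j (length s))) f≈gρ'

  agree-initial : ∀ i → Agree 1 (λ _ → 1ℤ) (initial i) (initial 0)
  agree-initial i = agree coeff₀
    where
    coeff₀ : ∀ v n → n ℕ.+ v < 1 → initial i v n ≡ (initial 0 v ⋆ (λ _ → 1ℤ)) n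
    coeff₀ zero    zero    _             = refl
    coeff₀ zero    (suc n) (s≤s ())
    coeff₀ (suc v) n       (s≤s n+1+v≤0) with subst (_≤ 0) (ℕ.+-suc n v) n+1+v≤0
    ... | ()

  quotCoeff-stable : ∀ i k p → k ≤ length p → ∃ λ c → ∀ e (num den : Series) →
                     (∀ n → num n ≡ total (run (initial i) (p ++ e)) n) →
                     (∀ n → den n ≡ total (run (initial 0) (p ++ e)) n) →
                     quotCoeff num den k ≡ c
  quotCoeff-stable i k p k≤|p| with agree-run-refine p refl (agree-initial i)
  ... | ρ , agree-prefix = ρ k , stable
    where
    stable : ∀ e (num den : Series) → (∀ n → num n ≡ total (run (initial i) (p ++ e)) n) →
             (∀ n → den n ≡ total (run (initial 0) (p ++ e)) n) → quotCoeff num den k ≡ ρ k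
    stable e num den num≡ den≡ = quotCoeff-unique num den ρ k den₀≡1 num≡den⋆ρ k ℕ.≤-refl
      where
      f≈gρ : Agree (suc (length p)) ρ (run (initial i) (p ++ e)) (run (initial 0) (p ++ e))
      f≈gρ = subst₂ (Agree (suc (length p)) ρ) (sym (foldl-++ _ (initial i) p e)) (sym (foldl-++ _ (initial 0) p e))
                    (agree-run e agree-prefix)
      den₀≡1 : den 0 ≡ 1ℤ
      den₀≡1 = trans (den≡ 0) (total-normalised (run (initial 0) (p ++ e)) (run-normalised (p ++ e) (initial 0) refl))
      num≡den⋆ρ : ∀ n → n ≤ k → num n ≡ (den ⋆ ρ) n
      num≡den⋆ρ n n≤k = trans (num≡ n) (trans (total-agree f≈gρ n (s≤s (ℕ.≤-trans n≤k k≤|p|)))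
                                             (⋆-congˡ ρ n (λ t _ → sym (den≡ t))))

  ∑ₗ-assignments-suc : ∀ N F →
                       ∑ₗ (assignments (suc N) m) F ≡ ∑[ v < suc m ] ∑ₗ (assignments N m) (λ σ → F (toℕ v ∷ σ))
  ∑ₗ-assignments-suc N F = begin
    ∑ₗ (concatMap (λ v → map (v ∷_) A) (upTo (suc m))) F ≡⟨ ∑ₗ-concatMap (λ v → map (v ∷_) A) (upTo (suc m)) F ⟩
    ∑ₗ (upTo (suc m)) (λ v → ∑ₗ (map (v ∷_) A) F)        ≡⟨ ∑ₗ-upTo (suc m) (λ v → ∑ₗ (map (v ∷_) A) F) ⟩
    ∑[ v < suc m ] ∑ₗ (map (toℕ v ∷_) A) F               ≡⟨ sum-cong-≗ {suc m} (λ v → ∑ₗ-map (toℕ v ∷_) A F) ⟩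
    ∑[ v < suc m ] ∑ₗ A (λ σ → F (toℕ v ∷ σ))            ∎
    where
    open ≡-Reasoning
    A : List (List ℕ)
    A = assignments N m

  ∑ₗ-assignments-cong : ∀ N {F G} → (∀ σ → length σ ≡ N → All (_≤ m) σ → F σ ≡ G σ) →
                        ∑ₗ (assignments N m) F ≡ ∑ₗ (assignments N m) G
  ∑ₗ-assignments-cong zero    F≗G = cong (_+ 0ℤ) (F≗G [] refl [])
  ∑ₗ-assignments-cong (suc N) {F} {G} F≗G =
    trans (∑ₗ-assignments-suc N F)
          (trans (sum-cong-≗ {suc m} (λ v → ∑ₗ-assignments-cong N
                    (λ σ len bounded → F≗G (toℕ v ∷ σ) (cong suc len) (Fin.toℕ≤pred[n] v ∷ bounded))))
                 (sym (∑ₗ-assignments-suc N G)))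

  weighted : State → List Dir → Series
  weighted f s n = ∑ₗ (assignments (suc (length s)) m)
                      (λ σ → if monotoneAlong s σ then shift (sum σ) (f (head₀ σ)) n else 0ℤ)

  weighted≡total-run : ∀ s f n → weighted f s n ≡ total (run f s) n
  weighted≡total-run [] f n =
    trans (∑ₗ-assignments-suc 0 (λ σ → shift (sum σ) (f (head₀ σ)) n))
          (sum-cong-≗ {suc m} (λ v → trans (ℤ.+-identityʳ _) (cong (λ k → shift k (f (toℕ v)) n) (ℕ.+-identityʳ (toℕ v)))))
  weighted≡total-run (d ∷ s) f n = begin
      weighted f (d ∷ s) n
    ≡⟨ ∑ₗ-assignments-suc (suc (length s)) term ⟩
      ∑[ v < suc m ] ∑ₗ A (λ σ → term (toℕ v ∷ σ))
    ≡⟨ sym (∑ₗ-∑-comm A (suc m) (λ σ v → term (toℕ v ∷ σ))) ⟩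
      ∑ₗ A (λ σ → ∑[ v < suc m ] term (toℕ v ∷ σ))
    ≡⟨ cong (foldr _+_ 0ℤ) (map-cong first-box A) ⟩
      weighted (step d f) s n
    ≡⟨ weighted≡total-run s (step d f) n ⟩
      total (run (step d f) s) n
    ∎
    where
    open ≡-Reasoning
    A : List (List ℕ)
    A = assignments (suc (length s)) m
    term : List ℕ → ℤ
    term σ = if monotoneAlong (d ∷ s) σ then shift (sum σ) (f (head₀ σ)) n else 0ℤ
    shift-gate : ∀ v σ b → (if b ∧ true then shift (v ℕ.+ sum σ) (f v) n else 0ℤ) ≡ shift (sum σ) (gate b (shift v (f v))) n
    shift-gate v σ true  = sym (shift-shift (sum σ) v (f v) n)
    shift-gate v σ false = sym (shift-zero (sum σ) n)
    first-box : ∀ σ → ∑[ v < suc m ] term (toℕ v ∷ σ)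
                      ≡ (if monotoneAlong s σ then shift (sum σ) (step d f (head₀ σ)) n else 0ℤ)
    first-box σ with monotoneAlong s σ
    ... | false = sum-zero (suc m) (λ v → cong (λ b → if b then shift (toℕ v ℕ.+ sum σ) (f (toℕ v)) n else 0ℤ)
                                               (∧-zeroʳ (stepOK d (toℕ v) (head₀ σ))))
    ... | true  = trans (sum-cong-≗ {suc m} (λ v → shift-gate (toℕ v) σ (stepOK d (toℕ v) (head₀ σ))))
                        (sym (shift-sum (sum σ) (suc m) (λ v → gate (stepOK d (toℕ v) (head₀ σ)) (shift (toℕ v) (f (toℕ v)))) n))

  countPP : List (ℕ × ℕ) → ℕ → ℕ → ℕ
  countPP bs c n = length (filterᵇ (λ σ → isPPartition (zip bs σ) ∧ headOK c σ ∧ lastOK m σ ∧ (sum σ ≡ᵇ n))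
                                   (assignments (length bs) m))

  shift-initial : ∀ k c v n → shift k (initial c v) n ≡ (if (v ≤ᵇ c) ∧ (k ≡ᵇ n) then 1ℤ else 0ℤ)
  shift-initial zero    c v zero    with v ≤ᵇ c
  ... | true  = refl
  ... | false = refl
  shift-initial zero    c v (suc n) with v ≤ᵇ c
  ... | true  = refl
  ... | false = refl
  shift-initial (suc k) c v zero    with v ≤ᵇ c
  ... | true  = refl
  ... | false = refl
  shift-initial (suc k) c v (suc n) = shift-initial k c v n

  lastOK-bounded : ∀ σ → All (_≤ m) σ → lastOK m σ ≡ true
  lastOK-bounded []          _              = refl
  lastOK-bounded (v ∷ [])    (v≤m ∷ [])     = T-≡ .Equivalence.to (ℕ.≤⇒≤ᵇ v≤m)
  lastOK-bounded (v ∷ w ∷ σ) (_ ∷ bounded)  = lastOK-bounded (w ∷ σ) bounded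

  length-walk : ∀ p s → length (walk p s) ≡ suc (length s)
  length-walk p []      = refl
  length-walk p (d ∷ s) = cong suc (length-walk (move d p) s)

  countPP-walk : ∀ p s c n → + countPP (walk p s) c n ≡ weighted (initial c) s n
  countPP-walk p s c n = begin
      + countPP (walk p s) c n
    ≡⟨ cong (λ N → + length (filterᵇ P (assignments N m))) (length-walk p s) ⟩
      + length (filterᵇ P (assignments (suc (length s)) m))
    ≡⟨ length-filterᵇ P (assignments (suc (length s)) m) ⟩
      ∑ₗ (assignments (suc (length s)) m) (λ σ → if P σ then 1ℤ else 0ℤ)
    ≡⟨ ∑ₗ-assignments-cong (suc (length s)) indicator ⟩
      weighted (initial c) s n
    ∎
    where
    open ≡-Reasoning
    P : List ℕ → Bool
    P σ = isPPartition (zip (walk p s) σ) ∧ headOK c σ ∧ lastOK m σ ∧ (sum σ ≡ᵇ n)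
    indicator : ∀ σ → length σ ≡ suc (length s) → All (_≤ m) σ →
                (if P σ then 1ℤ else 0ℤ) ≡ (if monotoneAlong s σ then shift (sum σ) (initial c (head₀ σ)) n else 0ℤ)
    indicator (v ∷ σ) len bounded
      rewrite isPPartition-walk p s (v ∷ σ) len | lastOK-bounded (v ∷ σ) bounded | shift-initial (sum (v ∷ σ)) c v n
      with monotoneAlong s (v ∷ σ)
    ... | true  = refl
    ... | false = refl

  boxes-walk : ∀ as → 0 < numBoxes as → boxes as ≡ walk (0 , 0) (steps as)
  boxes-walk as N>0 with numBoxes as
  ... | suc _ = refl

  omegaCoeff≡total : ∀ c' as n → 0 < numBoxes as → + omegaCoeff m c' 1 as n ≡ total (run (initial (suc m ∸ c')) (steps as)) n
  omegaCoeff≡total c' as n N>0 = begin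
    + countPP (boxes as) (suc m ∸ c') n                   ≡⟨ cong (λ bs → + countPP bs (suc m ∸ c') n) (boxes-walk as N>0) ⟩
    + countPP (walk (0 , 0) (steps as)) (suc m ∸ c') n    ≡⟨ countPP-walk (0 , 0) (steps as) (suc m ∸ c') n ⟩
    weighted (initial (suc m ∸ c')) (steps as) n          ≡⟨ weighted≡total-run (steps as) (initial (suc m ∸ c')) n ⟩
    total (run (initial (suc m ∸ c')) (steps as)) n       ∎
    where open ≡-Reasoning

  rCoeffCF-stable : ∀ i k p → i ≤ m → k ≤ length p →
                    ∃ λ c → ∀ as → 0 < numBoxes as → p ⊑ steps as → rCoeffCF m i as k ≡ c
  rCoeffCF-stable i k p i≤m k≤|p| with quotCoeff-stable i k p k≤|p|
  ... | c , stable = c , λ { as N>0 (e , steps≡) →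
    stable e _ _ (λ n → trans (omegaCoeff≡total (suc m ∸ i) as n N>0)
                               (cong₂ (λ c s → total (run (initial c) s) n) m+1∸[m+1∸i]≡i steps≡))
                 (λ n → trans (omegaCoeff≡total (suc m) as n N>0)
                               (cong₂ (λ c s → total (run (initial c) s) n) (ℕ.n∸n≡0 (suc m)) steps≡)) }
    where
    m+1∸[m+1∸i]≡i : suc m ∸ (suc m ∸ i) ≡ i
    m+1∸[m+1∸i]≡i = ℕ.m∸[m∸n]≡n (ℕ.m≤n⇒m≤1+n i≤m)

module StripPrefix where

  open ListPrefix
  open import Data.Nat as ℕ using (suc; _+_; _∸_; _<_; z≤n; s≤s)
  import Data.Nat.Properties as ℕ
  open import Data.Nat.ListAction using (sum)
  open import Data.List using (List; []; _∷_; _++_; map; replicate; length; upTo; applyUpTo)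
  import Data.List.Properties as List
  open import Data.List.Relation.Unary.All as All using (All; []; _∷_)
  import Data.List.Relation.Unary.All.Properties as All
  open import Data.Product using (∃; _,_)
  open import Data.Sum using (inj₁; inj₂)
  open import Relation.Binary.PropositionalEquality

  stepsTail-⊑ : ∀ d y ys rest → stepsTail d (y ∷ ys) ⊑ stepsTail d (y ∷ ys ++ rest)
  stepsTail-⊑ d y []       []         = ⊑-refl _
  stepsTail-⊑ d y []       (r ∷ rest) = ⊑-++ʳ (stepsTail (flip d) (r ∷ rest)) (replicate-⊑ d (ℕ.m∸n≤m y 1))
  stepsTail-⊑ d y (z ∷ zs) rest       = ++⁺-⊑ (replicate y d) (stepsTail-⊑ (flip d) z zs rest)

  steps-⊑ : ∀ x xs rest → steps (x ∷ xs) ⊑ steps (x ∷ xs ++ rest)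
  steps-⊑ x []       []         = ⊑-refl _
  steps-⊑ x []       (r ∷ rest) = ⊑-++ʳ (stepsTail R (r ∷ rest)) (replicate-⊑ U (ℕ.∸-monoʳ-≤ x (s≤s z≤n)))
  steps-⊑ x (y ∷ ys) rest       = ++⁺-⊑ (replicate (x ∸ 1) U) (stepsTail-⊑ R y ys rest)

  length-stepsTail : ∀ d y ys → All (1 ≤_) (y ∷ ys) → length ys ≤ length (stepsTail d (y ∷ ys))
  length-stepsTail d y []       _            = z≤n
  length-stepsTail d y (z ∷ zs) (y≥1 ∷ pos) = begin
    suc (length zs)                                             ≤⟨ ℕ.+-mono-≤ y≥1 (length-stepsTail (flip d) z zs pos) ⟩
    y + length (stepsTail (flip d) (z ∷ zs))                    ≡⟨ cong (_+ _) (List.length-replicate y) ⟨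
    length (replicate y d) + length (stepsTail (flip d) (z ∷ zs)) ≡⟨ List.length-++ (replicate y d) ⟨
    length (stepsTail d (y ∷ z ∷ zs))                           ∎
    where open ℕ.≤-Reasoning

  length-steps : ∀ x y ys → All (1 ≤_) (y ∷ ys) → length ys ≤ length (steps (x ∷ y ∷ ys))
  length-steps x y ys pos = ℕ.≤-trans (length-stepsTail R y ys pos)
    (ℕ.≤-trans (ℕ.m≤n+m _ (length (replicate (x ∸ 1) U))) (ℕ.≤-reflexive (sym (List.length-++ (replicate (x ∸ 1) U)))))

  numBoxes-pos : ∀ x y ys → 1 ≤ x → 1 ≤ y → 0 < numBoxes (x ∷ y ∷ ys)
  numBoxes-pos x y ys x≥1 y≥1 = ℕ.m<n⇒0<n∸m (ℕ.+-mono-≤ x≥1 (ℕ.≤-trans y≥1 (ℕ.m≤m+n y (sum ys))))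

  prefix-suc : ∀ (a : ℕ → ℕ) M → prefix a (suc M) ≡ prefix a M ++ a (suc M) ∷ []
  prefix-suc a M = trans (cong (map a) (sym (List.upTo-∷ʳ (suc M)))) (List.map-++ a (upTo (suc M)) (suc M ∷ []))

  prefix-⊑ : ∀ (a : ℕ → ℕ) {L M} → L ≤ M → prefix a L ⊑ prefix a M
  prefix-⊑ a {L} {M} L≤M with ℕ.m≤n⇒m<n∨m≡n L≤M
  ... | inj₂ refl = ⊑-refl (prefix a L)
  prefix-⊑ a {L} {suc M} _ | inj₁ (s≤s L≤M) =
    subst (prefix a L ⊑_) (sym (prefix-suc a M)) (⊑-++ʳ (a (suc M) ∷ []) (prefix-⊑ a L≤M))

  rCoeffCF-prefix-stable : ∀ m i k (a : ℕ → ℕ) → (∀ t → 1 ≤ a t) → i ≤ m →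
                           ∃ λ c → ∀ as → prefix a (suc k) ⊑ as → rCoeffCF m i as k ≡ c
  rCoeffCF-prefix-stable m i k a pos i≤m =
    let c , stable = TransferMatrix.rCoeffCF-stable m i k (steps (a 0 ∷ a 1 ∷ later)) i≤m k≤#steps
    in c , λ { as (rest , refl) →
      stable (a 0 ∷ a 1 ∷ later ++ rest) (numBoxes-pos (a 0) (a 1) (later ++ rest) (pos 0) (pos 1))
             (steps-⊑ (a 0) (a 1 ∷ later) rest) }
    where
    later : List ℕ
    later = map a (applyUpTo (λ t → suc (suc t)) k)
    k≤#steps : k ≤ length (steps (a 0 ∷ a 1 ∷ later))
    k≤#steps = subst (_≤ length (steps (a 0 ∷ a 1 ∷ later)))
                     (trans (List.length-map a (applyUpTo (λ t → suc (suc t)) k)) (List.length-applyUpTo _ k))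
                     (length-steps (a 0) (a 1) later (pos 1 ∷ All.map⁺ (All.universal pos (applyUpTo (λ t → suc (suc t)) k))))

module ContinuedFraction where

  open ListPrefix
  open import Data.Nat as ℕ using (zero; suc; _+_; _*_; _∸_; _<_; z≤n; s≤s)
  import Data.Nat.Properties as ℕ
  open import Data.Nat.Coprimality using (1-coprimeTo)
  open import Data.Nat.DivMod using (_/_; _%_; [m+kn]%n≡m%n; m<n⇒m%n≡m; m<n⇒m/n≡0; +-distrib-/-∣ʳ; m*n/n≡m)
  open import Data.Nat.Divisibility using (divides)
  open import Data.Nat.Tactic.RingSolver using (solve-∀)
  open import Data.Integer as ℤ using (+_; -[1+_]; _⊖_)
  import Data.Integer.Properties as ℤ
  open import Data.Rational as ℚ using (mkℚ; ↥_; ↧ₙ_; toℚᵘ)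
  import Data.Rational.Properties as ℚ
  import Data.Rational.Unnormalised as ℚᵘ
  import Data.Rational.Unnormalised.Properties as ℚᵘ
  open import Data.List using (List; []; _∷_; _++_; applyUpTo)
  import Data.List.Properties as List
  open import Data.Product using (∃; _,_; proj₁; proj₂)
  open import Data.Sum using (inj₁; inj₂)
  open import Data.Unit using (⊤; tt)
  open import Function using (_∘_)
  open import Relation.Binary.PropositionalEquality

  -- |p/q − P/Q| < 1/e, with the denominators cleared.
  Close : ℕ → ℕ × ℕ → ℕ × ℕ → Set
  Close e (p , q) (P , Q) = (p * Q * e < P * q * e + q * Q) × (P * q * e < p * Q * e + q * Q)

  module _ where
    open ℕ.≤-Reasoning

    close⇒above-floor : ∀ a₀ A e p q P Q → 1 ≤ A → 2 * A ≤ e → P ≤ A * Q →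
      (a₀ * P + Q) * q * e < p * P * e + q * P → q + 2 * A * (a₀ * q) < 2 * A * p
    close⇒above-floor a₀ A e p q P Q A≥1 2A≤e P≤AQ close =
      ℕ.*-cancelˡ-< (P * e) _ _ (ℕ.+-cancelʳ-< (P * q * e) _ _ (begin-strict
        P * e * (q + 2 * A * (a₀ * q)) + P * q * e       ≡⟨ expandˡ P e q A a₀ ⟩
        2 * A * (a₀ * P * q * e) + 2 * (P * q * e)       ≤⟨ ℕ.+-monoʳ-≤ (2 * A * (a₀ * P * q * e))
                                                              (ℕ.*-monoʳ-≤ 2 (ℕ.*-monoˡ-≤ e (ℕ.*-monoˡ-≤ q P≤AQ))) ⟩
        2 * A * (a₀ * P * q * e) + 2 * (A * Q * q * e)   ≡⟨ collect A a₀ P q e Q ⟩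
        2 * A * ((a₀ * P + Q) * q * e)                   <⟨ ℕ.*-monoʳ-< (2 * A) {{ℕ.>-nonZero 2A≥1}} close ⟩
        2 * A * (p * P * e + q * P)                      ≡⟨ expandʳ A p P e q ⟩
        P * e * (2 * A * p) + 2 * A * (q * P)            ≤⟨ ℕ.+-monoʳ-≤ (P * e * (2 * A * p)) (ℕ.*-monoˡ-≤ (q * P) 2A≤e) ⟩
        P * e * (2 * A * p) + e * (q * P)                ≡⟨ cong (_+_ (P * e * (2 * A * p))) (ℕ.*-comm e (q * P)) ⟩
        P * e * (2 * A * p) + q * P * e                  ≡⟨ cong (λ x → P * e * (2 * A * p) + x * e) (ℕ.*-comm q P) ⟩
        P * e * (2 * A * p) + P * q * e                  ∎))
      where
      2A≥1 : 1 ≤ 2 * A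
      2A≥1 = ℕ.*-mono-≤ {1} {2} (s≤s z≤n) A≥1
      expandˡ : ∀ P e q A a₀ → P * e * (q + 2 * A * (a₀ * q)) + P * q * e ≡ 2 * A * (a₀ * P * q * e) + 2 * (P * q * e)
      expandˡ = solve-∀
      collect : ∀ A a₀ P q e Q → 2 * A * (a₀ * P * q * e) + 2 * (A * Q * q * e) ≡ 2 * A * ((a₀ * P + Q) * q * e)
      collect = solve-∀
      expandʳ : ∀ A p P e q → 2 * A * (p * P * e + q * P) ≡ P * e * (2 * A * p) + 2 * A * (q * P)
      expandʳ = solve-∀

    close⇒below-ceiling : ∀ a₀ E e p q P Q T → 1 ≤ E → P ≡ Q + T → P ≤ E * T → E ≤ e →
      p * P * e < (a₀ * P + Q) * q * e + q * P → p < q + a₀ * q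
    close⇒below-ceiling a₀ E e p q P Q T E≥1 P≡Q+T P≤ET E≤e close = ℕ.*-cancelˡ-< (E * P * e) _ _ (begin-strict
        E * P * e * p                                            ≡⟨ reorder E P e p ⟩
        E * (p * P * e)                                          <⟨ ℕ.*-monoʳ-< E {{ℕ.>-nonZero E≥1}} close ⟩
        E * ((a₀ * P + Q) * q * e + q * P)                       ≡⟨ expand E a₀ P Q q e ⟩
        E * (a₀ * P * q * e) + E * (Q * q * e) + E * (q * P)     ≤⟨ ℕ.+-monoʳ-≤ (E * (a₀ * P * q * e) + E * (Q * q * e))
                                                                      (ℕ.*-monoˡ-≤ (q * P) E≤e) ⟩
        E * (a₀ * P * q * e) + E * (Q * q * e) + e * (q * P)     ≡⟨ cong (_+_ (E * (a₀ * P * q * e) + E * (Q * q * e)))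
                                                                      (reorder′ e q P) ⟩
        E * (a₀ * P * q * e) + E * (Q * q * e) + P * q * e       ≤⟨ ℕ.+-monoʳ-≤ (E * (a₀ * P * q * e) + E * (Q * q * e))
                                                                      (ℕ.*-monoˡ-≤ e (ℕ.*-monoˡ-≤ q P≤ET)) ⟩
        E * (a₀ * P * q * e) + E * (Q * q * e) + E * T * q * e   ≡⟨ collect P P≡Q+T ⟩
        E * P * e * (q + a₀ * q)                                 ∎)
      where
      reorder : ∀ E P e p → E * P * e * p ≡ E * (p * P * e)
      reorder = solve-∀
      reorder′ : ∀ e q P → e * (q * P) ≡ P * q * e
      reorder′ = solve-∀
      expand : ∀ E a₀ P Q q e → E * ((a₀ * P + Q) * q * e + q * P) ≡ E * (a₀ * P * q * e) + E * (Q * q * e) + E * (q * P)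
      expand = solve-∀
      collect-sum : ∀ E a₀ Q T q e →
                    E * (a₀ * (Q + T) * q * e) + E * (Q * q * e) + E * T * q * e ≡ E * (Q + T) * e * (q + a₀ * q)
      collect-sum = solve-∀
      collect : ∀ P → P ≡ Q + T → E * (a₀ * P * q * e) + E * (Q * q * e) + E * T * q * e ≡ E * P * e * (q + a₀ * q)
      collect _ refl = collect-sum E a₀ Q T q e

    close⇒remainder-close : ∀ a₀ K e q z P Q → q * P < K * (z * Q) →
      Close (K * e) (a₀ * q + z , q) (a₀ * P + Q , P) → Close e (q , z) (P , Q)
    close⇒remainder-close a₀ K e q z P Q qP<KzQ (close₁ , close₂) = upper , lower
      where
      split₁ : ∀ a₀ q z P E → (a₀ * q + z) * P * E ≡ a₀ * q * P * E + z * P * E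
      split₁ = solve-∀
      split₂ : ∀ a₀ q z P E r → (a₀ * q + z) * P * E + r ≡ a₀ * q * P * E + (z * P * E + r)
      split₂ = solve-∀
      split₃ : ∀ a₀ q Q P E → (a₀ * P + Q) * q * E ≡ a₀ * q * P * E + Q * q * E
      split₃ = solve-∀
      split₄ : ∀ a₀ q Q P E r → (a₀ * P + Q) * q * E + r ≡ a₀ * q * P * E + (Q * q * E + r)
      split₄ = solve-∀
      scaleˡ : ∀ K q Q e → K * (q * Q * e) ≡ Q * q * (K * e)
      scaleˡ = solve-∀
      scaleʳ : ∀ K q Q e z P → z * P * (K * e) + K * (q * Q) ≡ K * (P * z * e + q * Q)
      scaleʳ = solve-∀
      zPKe<QqKe+qP : z * P * (K * e) < Q * q * (K * e) + q * P
      zPKe<QqKe+qP = ℕ.+-cancelˡ-< (a₀ * q * P * (K * e)) _ _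
        (subst₂ _<_ (split₁ a₀ q z P (K * e)) (split₄ a₀ q Q P (K * e) (q * P)) close₁)
      QqKe<zPKe+qP : Q * q * (K * e) < z * P * (K * e) + q * P
      QqKe<zPKe+qP = ℕ.+-cancelˡ-< (a₀ * q * P * (K * e)) _ _
        (subst₂ _<_ (split₃ a₀ q Q P (K * e)) (split₂ a₀ q z P (K * e) (q * P)) close₂)
      upper : q * Q * e < P * z * e + z * Q
      upper = ℕ.*-cancelˡ-< K _ _ (begin-strict
        K * (q * Q * e)                   ≡⟨ scaleˡ K q Q e ⟩
        Q * q * (K * e)                   <⟨ QqKe<zPKe+qP ⟩
        z * P * (K * e) + q * P           <⟨ ℕ.+-monoʳ-< (z * P * (K * e)) qP<KzQ ⟩
        z * P * (K * e) + K * (z * Q)     ≡⟨ scaleʳ K z Q e z P ⟩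
        K * (P * z * e + z * Q)           ∎)
      lower : P * z * e < q * Q * e + z * Q
      lower = ℕ.*-cancelˡ-< K _ _ (begin-strict
        K * (P * z * e)                   ≡⟨ scaleˡ K P z e ⟩
        z * P * (K * e)                   <⟨ zPKe<QqKe+qP ⟩
        Q * q * (K * e) + q * P           <⟨ ℕ.+-monoʳ-< (Q * q * (K * e)) qP<KzQ ⟩
        Q * q * (K * e) + K * (z * Q)     ≡⟨ scaleʳ K z Q e Q q ⟩
        K * (q * Q * e + z * Q)           ∎)

  -- cfPQ (prefix a M), with the list written so that convergent a (suc M) unfolds along a ∘ suc.
  convergent : (ℕ → ℕ) → ℕ → ℕ × ℕ
  convergent a M = cfPQ (applyUpTo a (suc M))

  numer denom : (ℕ → ℕ) → ℕ → ℕ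
  numer a M = proj₁ (convergent a M)
  denom a M = proj₂ (convergent a M)

  convergent-suc : ∀ a M → convergent a (suc M) ≡ (a 0 * numer (a ∘ suc) M + denom (a ∘ suc) M , numer (a ∘ suc) M)
  convergent-suc a M with cfPQ (applyUpTo (a ∘ suc) (suc M))
  ... | _ , _ = refl

  convergent-bounds : ∀ a → (∀ t → 1 ≤ a t) → ∀ M →
    1 ≤ denom a M × denom a M ≤ numer a M × numer a M ≤ denom a M + a 0 * denom a M
  convergent-bounds a pos zero    = ℕ.≤-refl , pos 0 , ℕ.≤-trans (ℕ.≤-reflexive (sym (ℕ.*-identityʳ (a 0)))) (ℕ.m≤n+m (a 0 * 1) 1)
  convergent-bounds a pos (suc M) rewrite convergent-suc a M with convergent-bounds (a ∘ suc) (pos ∘ suc) M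
  ... | Q≥1 , Q≤P , _ = ℕ.≤-trans Q≥1 Q≤P
                      , ℕ.≤-trans (ℕ.m≤n*m P (a 0) {{ℕ.>-nonZero (pos 0)}}) (ℕ.m≤m+n (a 0 * P) Q)
                      , ℕ.≤-trans (ℕ.+-monoʳ-≤ (a 0 * P) Q≤P) (ℕ.≤-reflexive (ℕ.+-comm (a 0 * P) P))
    where
    P Q : ℕ
    P = numer (a ∘ suc) M
    Q = denom (a ∘ suc) M

  convergent-gap : ∀ a → (∀ t → 1 ≤ a t) → ∀ M →
    ∃ λ T → numer a (suc M) ≡ denom a (suc M) + T × numer a (suc M) ≤ suc (a 0 * suc (a 1)) * T
  convergent-gap a pos M rewrite convergent-suc a M
    with a 0 | pos 0 | numer (a ∘ suc) M | denom (a ∘ suc) M | convergent-bounds (a ∘ suc) (pos ∘ suc) M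
  ... | suc c | _ | P | Q | _ , _ , P≤Q+a₁Q = c * P + Q , peel c P Q , (begin
      suc c * P + Q                          ≤⟨ ℕ.+-monoˡ-≤ Q (ℕ.*-monoʳ-≤ (suc c) P≤Q+a₁Q) ⟩
      suc c * (Q + a 1 * Q) + Q              ≡⟨ regroup c (a 1) Q ⟩
      suc (suc c * suc (a 1)) * Q            ≤⟨ ℕ.*-monoʳ-≤ (suc (suc c * suc (a 1))) (ℕ.m≤n+m Q (c * P)) ⟩
      suc (suc c * suc (a 1)) * (c * P + Q)  ∎)
    where
    open ℕ.≤-Reasoning
    peel : ∀ c P Q → suc c * P + Q ≡ P + (c * P + Q)
    peel = solve-∀
    regroup : ∀ c a₁ Q → suc c * (Q + a₁ * Q) + Q ≡ suc (suc c * suc a₁) * Q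
    regroup = solve-∀

  -- For X = [a₀; a₁, a₂, …] we have 1/A ≤ X − a₀ ≤ 1 − 1/E, so a distance below 1/(2A) and 1/E
  -- to X fixes ⌊p/q⌋ = a₀, and inverting the fractional part magnifies distances by less than 2A·A.
  scale : (ℕ → ℕ) → ℕ
  scale a = 2 * A * (A * E)
    where
    A E : ℕ
    A = suc (a 1)
    E = suc (a 1 * suc (a 2))

  close⇒first-quotient : ∀ a → (∀ t → 1 ≤ a t) → ∀ e p q M → 1 ≤ e →
    Close (scale a * e) (p , q) (convergent a (suc (suc M))) →
    a 0 * q < p × p < q + a 0 * q × Close e (q , p ∸ a 0 * q) (convergent (a ∘ suc) (suc M))
  close⇒first-quotient a pos e p q M e≥1 close = a₀q<p , p<q+a₀q , remainder-close
    where
    open ℕ.≤-Reasoning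
    a₀ A E K P Q : ℕ
    a₀ = a 0
    A = suc (a 1)
    E = suc (a 1 * suc (a 2))
    K = scale a
    P = numer (a ∘ suc) (suc M)
    Q = denom (a ∘ suc) (suc M)
    close′ : Close (K * e) (p , q) (a₀ * P + Q , P)
    close′ = subst (Close (K * e) (p , q)) (convergent-suc a (suc M)) close
    bounds : 1 ≤ Q × Q ≤ P × P ≤ Q + a 1 * Q
    bounds = convergent-bounds (a ∘ suc) (pos ∘ suc) (suc M)
    P≥1 : 1 ≤ P
    P≥1 = ℕ.≤-trans (proj₁ bounds) (proj₁ (proj₂ bounds))
    P≤AQ : P ≤ A * Q
    P≤AQ = proj₂ (proj₂ bounds)
    E≤Ke : E ≤ K * e
    E≤Ke = begin
      E                  ≤⟨ ℕ.m≤n*m E A ⟩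
      A * E              ≤⟨ ℕ.m≤n*m (A * E) (2 * A) ⟩
      K                  ≤⟨ ℕ.m≤m*n K e {{ℕ.>-nonZero e≥1}} ⟩
      K * e              ∎
    above : q + 2 * A * (a₀ * q) < 2 * A * p
    above = close⇒above-floor a₀ A (K * e) p q P Q (s≤s z≤n)
              (ℕ.≤-trans (ℕ.m≤m*n (2 * A) (A * E)) (ℕ.m≤m*n K e {{ℕ.>-nonZero e≥1}})) P≤AQ (proj₂ close′)
    a₀q<p : a₀ * q < p
    a₀q<p = ℕ.*-cancelˡ-< (2 * A) _ _ (ℕ.≤-<-trans (ℕ.m≤n+m (2 * A * (a₀ * q)) q) above)
    p<q+a₀q : p < q + a₀ * q
    p<q+a₀q with convergent-gap (a ∘ suc) (pos ∘ suc) M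
    ... | T , P≡Q+T , P≤ET = close⇒below-ceiling a₀ E (K * e) p q P Q T (s≤s z≤n) P≡Q+T P≤ET E≤Ke (proj₁ close′)
    z : ℕ
    z = p ∸ a₀ * q
    p≡a₀q+z : p ≡ a₀ * q + z
    p≡a₀q+z = sym (ℕ.m+[n∸m]≡n (ℕ.<⇒≤ a₀q<p))
    q<2Az : q < 2 * A * z
    q<2Az = ℕ.+-cancelʳ-< (2 * A * (a₀ * q)) q (2 * A * z) (begin-strict
      q + 2 * A * (a₀ * q)       <⟨ above ⟩
      2 * A * p                  ≡⟨ cong (2 * A *_) p≡a₀q+z ⟩
      2 * A * (a₀ * q + z)       ≡⟨ trans (ℕ.*-distribˡ-+ (2 * A) (a₀ * q) z) (ℕ.+-comm (2 * A * (a₀ * q)) (2 * A * z)) ⟩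
      2 * A * z + 2 * A * (a₀ * q) ∎)
    rearrange : ∀ A E z Q → 2 * A * z * (A * Q) * E ≡ 2 * A * (A * E) * (z * Q)
    rearrange = solve-∀
    qP<KzQ : q * P < K * (z * Q)
    qP<KzQ = begin-strict
      q * P                      <⟨ ℕ.*-monoˡ-< P {{ℕ.>-nonZero P≥1}} q<2Az ⟩
      2 * A * z * P              ≤⟨ ℕ.*-monoʳ-≤ (2 * A * z) P≤AQ ⟩
      2 * A * z * (A * Q)        ≤⟨ ℕ.m≤m*n (2 * A * z * (A * Q)) E ⟩
      2 * A * z * (A * Q) * E    ≡⟨ rearrange A E z Q ⟩
      K * (z * Q)                ∎
    remainder-close : Close e (q , z) (P , Q)
    remainder-close = close⇒remainder-close a₀ K e q z P Q qP<KzQ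
                        (subst (λ p → Close (K * e) (p , q) (a₀ * P + Q , P)) p≡a₀q+z close′)

  precision : ℕ → (ℕ → ℕ) → ℕ
  precision zero    a = scale a * 1
  precision (suc L) a = scale a * precision L (a ∘ suc)

  precision≥1 : ∀ L a → 1 ≤ precision L a
  precision≥1 zero    a = s≤s z≤n
  precision≥1 (suc L) a = ℕ.*-mono-≤ {1} {scale a} (s≤s z≤n) (precision≥1 L (a ∘ suc))

  EuclidPrefix : List ℕ → ℕ → ℕ → Set
  EuclidPrefix []       p q = ⊤
  EuclidPrefix (c ∷ cs) p q = c * q < p × p < q + c * q × EuclidPrefix cs q (p ∸ c * q)

  close⇒EuclidPrefix : ∀ L a → (∀ t → 1 ≤ a t) → ∀ p q M₀ →
    (∀ M → M₀ ≤ M → Close (precision L a) (p , q) (convergent a M)) → EuclidPrefix (applyUpTo a (suc L)) p q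
  close⇒EuclidPrefix zero    a pos p q M₀ close =
    let a₀q<p , p<q+a₀q , _ = close⇒first-quotient a pos 1 p q M₀ (s≤s z≤n) (close (suc (suc M₀)) (ℕ.m≤n+m M₀ 2))
    in a₀q<p , p<q+a₀q , tt
  close⇒EuclidPrefix (suc L) a pos p q M₀ close =
    let a₀q<p , p<q+a₀q , _ = first-quotient M₀ ℕ.≤-refl
    in a₀q<p , p<q+a₀q , close⇒EuclidPrefix L (a ∘ suc) (pos ∘ suc) q (p ∸ a 0 * q) (suc M₀) remainder-close
    where
    first-quotient : ∀ M → M₀ ≤ M → a 0 * q < p × p < q + a 0 * q
                                    × Close (precision L (a ∘ suc)) (q , p ∸ a 0 * q) (convergent (a ∘ suc) (suc M))
    first-quotient M M₀≤M = close⇒first-quotient a pos (precision L (a ∘ suc)) p q M (precision≥1 L (a ∘ suc))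
                                  (close (suc (suc M)) (ℕ.≤-trans M₀≤M (ℕ.m≤n+m M 2)))
    remainder-close : ∀ M → suc M₀ ≤ M → Close (precision L (a ∘ suc)) (q , p ∸ a 0 * q) (convergent (a ∘ suc) M)
    remainder-close (suc M) (s≤s M₀≤M) = proj₂ (proj₂ (first-quotient M M₀≤M))

  cfNat-step : ∀ f q c r → 0 < r → r < suc q → cfNat (suc f) (r + c * suc q) (suc q) ≡ c ∷ cfNat f (suc q) r
  cfNat-step f q c (suc r) _ r<q = unfold (trans ([m+kn]%n≡m%n (suc r) c (suc q)) (m<n⇒m%n≡m r<q))
    where
    open ≡-Reasoning
    quotient : (suc r + c * suc q) / suc q ≡ c
    quotient = begin
      (suc r + c * suc q) / suc q             ≡⟨ +-distrib-/-∣ʳ (suc r) (divides c refl) ⟩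
      suc r / suc q + c * suc q / suc q       ≡⟨ cong₂ _+_ (m<n⇒m/n≡0 r<q) (m*n/n≡m c (suc q)) ⟩
      c                                       ∎
    unfold : (suc r + c * suc q) % suc q ≡ suc r → cfNat (suc f) (suc r + c * suc q) (suc q) ≡ c ∷ cfNat f (suc q) (suc r)
    unfold remainder rewrite remainder = cong (_∷ cfNat f (suc q) (suc r)) quotient

  EuclidPrefix⇒⊑cfNat : ∀ cs f p q → 0 < q → q < f → EuclidPrefix cs p q → cs ⊑ cfNat f p q
  EuclidPrefix⇒⊑cfNat []       f       p q       _ _         _ = cfNat f p q , refl
  EuclidPrefix⇒⊑cfNat (c ∷ cs) (suc f) p (suc q) _ (s≤s q<f) (cq<p , p<q+cq , prefix) =
    let rest , eq = EuclidPrefix⇒⊑cfNat cs f (suc q) r (ℕ.m<n⇒0<n∸m cq<p) (ℕ.<-≤-trans r<q q<f) prefix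
    in rest , (begin
      cfNat (suc f) p (suc q)               ≡⟨ cong (λ p → cfNat (suc f) p (suc q)) (sym (ℕ.m∸n+n≡m (ℕ.<⇒≤ cq<p))) ⟩
      cfNat (suc f) (r + c * suc q) (suc q) ≡⟨ cfNat-step f q c r (ℕ.m<n⇒0<n∸m cq<p) r<q ⟩
      c ∷ cfNat f (suc q) r                 ≡⟨ cong (c ∷_) eq ⟩
      c ∷ cs ++ rest                        ∎)
    where
    open ≡-Reasoning
    r : ℕ
    r = p ∸ c * suc q
    r<q : r < suc q
    r<q = ℕ.m<n+o⇒m∸n<o p (c * suc q) (subst (p <_) (ℕ.+-comm (suc q) (c * suc q)) p<q+cq)

  reciprocal : ℕ → ℚ
  reciprocal e-1 = mkℚ (+ 1) e-1 (1-coprimeTo (suc e-1))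

  reciprocal-pos : ∀ e-1 → ℚ.0ℚ ℚ.< reciprocal e-1
  reciprocal-pos e-1 = ℚ.*<* (ℤ.+<+ (s≤s z≤n))

  ∣⊖∣*e<⇒< : ∀ A B e c → ℤ.∣ A ⊖ B ∣ * e < c → A * e < B * e + c
  ∣⊖∣*e<⇒< A B e c lt with ℕ.≤-total B A
  ... | inj₁ B≤A = begin-strict
    A * e                   ≡⟨ cong (_* e) (ℕ.m+[n∸m]≡n B≤A) ⟨
    (B + (A ∸ B)) * e       ≡⟨ ℕ.*-distribʳ-+ e B (A ∸ B) ⟩
    B * e + (A ∸ B) * e     <⟨ ℕ.+-monoʳ-< (B * e) (subst (λ d → d * e < c) ∣A⊖B∣≡A∸B lt) ⟩
    B * e + c               ∎
    where
    open ℕ.≤-Reasoning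
    ∣A⊖B∣≡A∸B : ℤ.∣ A ⊖ B ∣ ≡ A ∸ B
    ∣A⊖B∣≡A∸B = trans (ℤ.∣m⊖n∣≡∣n⊖m∣ A B) (ℤ.∣⊖∣-≤ B≤A)
  ... | inj₂ A≤B = ℕ.≤-<-trans (ℕ.*-monoˡ-≤ e A≤B) (ℕ.m<m+n (B * e) (ℕ.≤-<-trans z≤n lt))

  -- Computed in ℚᵘ, where y − P/Q is literally (pQ − Pq)/(qQ).
  distance<⇒Close : ∀ (y : ℚ) P Q-1 e-1 → 1ℚ ℚ.≤ y →
    ℚ.∣ y ℚ.- (+ P) ℚ./ suc Q-1 ∣ ℚ.< reciprocal e-1 → Close (suc e-1) (ℤ.∣ ↥ y ∣ , ↧ₙ y) (P , suc Q-1)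
  distance<⇒Close (mkℚ -[1+ _ ] _ _) P Q-1 e-1 (ℚ.*≤* ())
  distance<⇒Close y@(mkℚ (+ p) q-1 _) P Q-1 e-1 _ lt with ℚᵘ.<-respˡ-≃ unnormalised (ℚ.toℚᵘ-mono-< lt)
    where
    x : ℚ
    x = (+ P) ℚ./ suc Q-1
    unnormalised : toℚᵘ ℚ.∣ y ℚ.- x ∣ ℚᵘ.≃ ℚᵘ.∣ toℚᵘ y ℚᵘ.- ℚᵘ.mkℚᵘ (+ P) Q-1 ∣
    unnormalised = ℚᵘ.≃-trans (ℚ.toℚᵘ-homo-∣-∣ (y ℚ.- x))
                     (ℚᵘ.∣-∣-cong (ℚᵘ.≃-trans (ℚ.toℚᵘ-homo-+ y (ℚ.- x))
                       (ℚᵘ.+-congʳ (toℚᵘ y) (ℚᵘ.≃-trans (ℚ.toℚᵘ-homo‿- x)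
                         (ℚᵘ.-‿cong (ℚ.toℚᵘ-fromℚᵘ (ℚᵘ.mkℚᵘ (+ P) Q-1)))))))
  ... | ℚᵘ.*<* lt′ = ∣⊖∣*e<⇒< (p * suc Q-1) (P * suc q-1) (suc e-1) (suc q-1 * suc Q-1) distance<
                   , ∣⊖∣*e<⇒< (P * suc q-1) (p * suc Q-1) (suc e-1) (suc q-1 * suc Q-1)
                       (subst (λ d → d * suc e-1 < suc q-1 * suc Q-1) (ℤ.∣m⊖n∣≡∣n⊖m∣ (p * suc Q-1) (P * suc q-1)) distance<)
    where
    numerator≡ : + p ℤ.* + suc Q-1 ℤ.+ ℤ.- (+ P) ℤ.* + suc q-1 ≡ (p * suc Q-1) ⊖ (P * suc q-1)
    numerator≡ = trans (cong₂ ℤ._+_ (sym (ℤ.pos-* p (suc Q-1)))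
                                     (trans (sym (ℤ.neg-distribˡ-* (+ P) (+ suc q-1))) (cong ℤ.-_ (sym (ℤ.pos-* P (suc q-1))))))
                       (ℤ.m-n≡m⊖n (p * suc Q-1) (P * suc q-1))
    distance< : ℤ.∣ (p * suc Q-1) ⊖ (P * suc q-1) ∣ * suc e-1 < suc q-1 * suc Q-1
    distance< = subst (λ n → n * suc e-1 < suc q-1 * suc Q-1) (cong ℤ.∣_∣ numerator≡)
                  (ℤ.drop‿+<+ (subst₂ ℤ._<_ (sym (ℤ.pos-* ℤ.∣ + p ℤ.* + suc Q-1 ℤ.+ ℤ.- (+ P) ℤ.* + suc q-1 ∣ (suc e-1)))
                                             (ℤ.*-identityˡ _) lt′))

  prefix⊑cfℚ-eventually : ∀ L a → (∀ t → 1 ≤ a t) →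
    (y : ℕ → ℚ) → (∀ n → 1ℚ ℚ.≤ y n) → ConvergesToCF y a →
    ∃ λ N → ∀ n → N ≤ n → prefix a L ⊑ cfℚ (y n)
  prefix⊑cfℚ-eventually L a pos y y≥1 y→x =
    let N , close-from = y→x (reciprocal e-1) (reciprocal-pos e-1)
    in N , λ n N≤n → let M₀ , close = close-from n N≤n in
      subst (_⊑ cfℚ (y n)) (sym (List.map-upTo a (suc L)))
        (EuclidPrefix⇒⊑cfNat (applyUpTo a (suc L)) (suc (↧ₙ y n)) ℤ.∣ ↥ y n ∣ (↧ₙ y n) (s≤s z≤n) (ℕ.n<1+n _)
          (close⇒EuclidPrefix L a pos ℤ.∣ ↥ y n ∣ (↧ₙ y n) M₀ (λ M M₀≤M → convergent-close n M (close M M₀≤M))))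
    where
    e-1 : ℕ
    e-1 = precision L a ∸ 1
    suc-∸1 : ∀ {n} → 1 ≤ n → suc (n ∸ 1) ≡ n
    suc-∸1 (s≤s _) = refl
    convergent-close : ∀ n M → ℚ.∣ y n ℚ.- cfValue (prefix a M) ∣ ℚ.< reciprocal e-1 →
                       Close (precision L a) (ℤ.∣ ↥ y n ∣ , ↧ₙ y n) (convergent a M)
    convergent-close n M lt = subst₂ (λ e Q → Close e (ℤ.∣ ↥ y n ∣ , ↧ₙ y n) (numer a M , Q))
      (suc-∸1 (precision≥1 L a)) (suc-∸1 (proj₁ (convergent-bounds a pos M)))
      (distance<⇒Close (y n) (numer a M) (denom a M ∸ 1) e-1 (y≥1 n)
        (subst (λ as → ℚ.∣ y n ℚ.- cfValue as ∣ ℚ.< reciprocal e-1) (List.map-upTo a (suc M)) lt))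

open ListPrefix using (_⊑_)
open StripPrefix using (rCoeffCF-prefix-stable; prefix-⊑)
open ContinuedFraction using (prefix⊑cfℚ-eventually)
open import Data.Nat using (suc)
open import Data.Product using (_,_)

mainTheorem4 : (m i : ℕ) → 1 ≤ m → i ≤ m →
    (a : ℕ → ℕ) → (∀ t → 1 ≤ a t) →
    (y : ℕ → ℚ) → (∀ n → 1ℚ ≤ℚ y n) → ConvergesToCF y a →
    (k : ℕ) → ∃[ c ] ((∃[ N ] ((n : ℕ) → N ≤ n → rCoeffℚ m i (y n) k ≡ c))
                    × (∃[ M ] ((n : ℕ) → M ≤ n → rCoeffCF m i (prefix a n) k ≡ c)))
mainTheorem4 m i _ i≤m a pos y y≥1 y→x k =
  let c , stable = rCoeffCF-prefix-stable m i k a pos i≤m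
      N , cf-prefix = prefix⊑cfℚ-eventually (suc k) a pos y y≥1 y→x
  in c , (N , λ n N≤n → stable (cfℚ (y n)) (cf-prefix n N≤n))
       , (suc k , λ n k<n → stable (prefix a n) (prefix-⊑ a k<n))
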